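{- Let $m\ge 7$ and $d\ge 2$ be integers, and for integers $k\ge1$, $n\ge 0$ set $B_k(n)=\binom{n+k-1}{k-1}$. Then $$B_{d+1}(2m-1)-(d+1)B_{d+1}(m-1)\ge d(m-6).$$ -}

module Defs where

open import Data.Nat using (ℕ; _+_; _∸_)
open import Data.Nat.Combinatorics using (_C_)

B : ℕ → ℕ → ℕ
B k n = (n + k ∸ 1) C (k ∸ 1)

-- Write n = m - 1, so the tail is d (n - 5) and the right-hand side is B (1+d) (2n+1). By the
-- absorption identity (1+d) B (2+d) n = (n+d+1) B (1+d) n, raising d by one multiplies the left
-- binomial by (n+d+1)/(d+1) and the right one by (2n+d+2)/(d+1); the gap between these factors
-- pays for the growth of the tail, so the inequality passes from d to d + 1 for every n ≥ 1.
-- It fails at d = 1, and at d = 2 it is an explicit quadratic inequality in n.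
module Submission where

open import Defs
open import Data.Nat using (ℕ; zero; suc; _+_; _*_; _∸_; _≤_; s≤s; z≤n)
open import Data.Nat.Properties using (+-suc; *-suc; *-zeroʳ; *-identityˡ; *-identityʳ; +-comm; m≤m+n; *-monoʳ-≤; *-cancelˡ-≤; module ≤-Reasoning)
open import Data.Nat.Combinatorics using (_C_; nC1≡n; k>n⇒nCk≡0; nCk+nC[k+1]≡[n+1]C[k+1])
open import Data.Nat.Tactic.RingSolver using (solve-∀)
open import Relation.Binary.PropositionalEquality using (_≡_; refl; sym; trans; cong; cong₂; subst₂; module ≡-Reasoning)

[1+k]*[1+n]C[1+k]≡[1+n]*nCk : ∀ n k → suc k * (suc n C suc k) ≡ suc n * (n C k)
[1+k]*[1+n]C[1+k]≡[1+n]*nCk n zero = trans (*-identityˡ (suc n C 1)) (trans (nC1≡n (suc n)) (sym (*-identityʳ (suc n))))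
[1+k]*[1+n]C[1+k]≡[1+n]*nCk zero (suc k)
  rewrite k>n⇒nCk≡0 {1} {suc (suc k)} (s≤s (s≤s z≤n)) | k>n⇒nCk≡0 {0} {suc k} (s≤s z≤n) =
  *-zeroʳ (suc (suc k))
[1+k]*[1+n]C[1+k]≡[1+n]*nCk (suc n) (suc k) = begin
  suc (suc k) * (suc (suc n) C suc (suc k))
    ≡⟨ cong (suc (suc k) *_) (sym (nCk+nC[k+1]≡[n+1]C[k+1] (suc n) (suc k))) ⟩
  suc (suc k) * (a + b)
    ≡⟨ distribute (suc k) a b ⟩
  (suc k * a + a) + suc (suc k) * b
    ≡⟨ cong₂ (λ u v → (u + a) + v) ([1+k]*[1+n]C[1+k]≡[1+n]*nCk n k) ([1+k]*[1+n]C[1+k]≡[1+n]*nCk n (suc k)) ⟩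
  (suc n * (n C k) + a) + suc n * (n C suc k)
    ≡⟨ collect (suc n) (n C k) (n C suc k) a ⟩
  suc n * (n C k + n C suc k) + a
    ≡⟨ cong (λ u → suc n * u + a) (nCk+nC[k+1]≡[n+1]C[k+1] n k) ⟩
  suc n * a + a
    ≡⟨ +-comm (suc n * a) a ⟩
  suc (suc n) * a
    ∎
  where
  open ≡-Reasoning
  a = suc n C suc k
  b = suc n C suc (suc k)
  distribute : ∀ k a b → suc k * (a + b) ≡ (k * a + a) + suc k * b
  distribute = solve-∀
  collect : ∀ p x y a → (p * x + a) + p * y ≡ p * (x + y) + a
  collect = solve-∀

B-suc : ∀ d n → B (suc d) n ≡ (n + d) C d
B-suc d n = cong (λ u → (u ∸ 1) C d) (+-suc n d)

B-absorption : ∀ d n → suc d * B (suc (suc d)) n ≡ suc (n + d) * B (suc d) n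
B-absorption d n = begin
  suc d * B (suc (suc d)) n
    ≡⟨ cong (suc d *_) (trans (B-suc (suc d) n) (cong (_C suc d) (+-suc n d))) ⟩
  suc d * (suc (n + d) C suc d)
    ≡⟨ [1+k]*[1+n]C[1+k]≡[1+n]*nCk (n + d) d ⟩
  suc (n + d) * ((n + d) C d)
    ≡⟨ cong (suc (n + d) *_) (sym (B-suc d n)) ⟩
  suc (n + d) * B (suc d) n
    ∎
  where open ≡-Reasoning

B-two : ∀ n → B 2 n ≡ suc n
B-two n = trans (B-suc 1 n) (trans (cong (_C 1) (+-comm n 1)) (nC1≡n (suc n)))

2*B-three : ∀ n → 2 * B 3 n ≡ suc (n + 1) * suc n
2*B-three n = trans (B-absorption 1 n) (cong (suc (n + 1) *_) (B-two n))

B-three-bound : ∀ c → 3 * B 3 (5 + c) + 2 * c ≤ B 3 (1 + 2 * (5 + c))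
B-three-bound c = *-cancelˡ-≤ 2 (begin
  2 * (3 * B 3 n + 2 * c)                          ≡⟨ regroup (B 3 n) c ⟩
  3 * (2 * B 3 n) + 4 * c                          ≡⟨ cong (λ u → 3 * u + 4 * c) (2*B-three n) ⟩
  3 * (suc (n + 1) * suc n) + 4 * c                ≤⟨ m≤m+n _ _ ⟩
  3 * (suc (n + 1) * suc n) + 4 * c + (c * c + 7 * c + 30) ≡⟨ expand c ⟩
  suc (N + 1) * suc N                              ≡⟨ sym (2*B-three N) ⟩
  2 * B 3 N                                        ∎)
  where
  open ≤-Reasoning
  n = 5 + c
  N = 1 + 2 * n
  regroup : ∀ x c → 2 * (3 * x + 2 * c) ≡ 3 * (2 * x) + 4 * c
  regroup = solve-∀
  expand : ∀ c → 3 * (suc ((5 + c) + 1) * suc (5 + c)) + 4 * c + (c * c + 7 * c + 30)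
                 ≡ suc ((1 + 2 * (5 + c)) + 1) * suc (1 + 2 * (5 + c))
  expand = solve-∀

-- x, y, x′, y′ stand for B (2+d) n, B (2+d) (2n+1), B (3+d) n, B (3+d) (2n+1); n = suc n′.
bound-step : ∀ d n′ c {x y x′ y′} →
  (2 + d) * x + (1 + d) * c ≤ y →
  (2 + d) * x′ ≡ suc (suc n′ + suc d) * x →
  (2 + d) * y′ ≡ suc ((1 + 2 * suc n′) + suc d) * y →
  (3 + d) * x′ + (2 + d) * c ≤ y′
bound-step d n′ c {x} {y} {x′} {y′} x≤y x′≡ y′≡ = *-cancelˡ-≤ (2 + d) (begin
  (2 + d) * ((3 + d) * x′ + (2 + d) * c)           ≡⟨ regroup (2 + d) (3 + d) x′ c ⟩
  (3 + d) * ((2 + d) * x′) + (2 + d) * (2 + d) * c ≡⟨ cong (λ u → (3 + d) * u + (2 + d) * (2 + d) * c) x′≡ ⟩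
  (3 + d) * (p * x) + (2 + d) * (2 + d) * c        ≤⟨ m≤m+n _ _ ⟩
  (3 + d) * (p * x) + (2 + d) * (2 + d) * c + slack ≡⟨ expand d n′ c x ⟩
  q * ((2 + d) * x + (1 + d) * c)                  ≤⟨ *-monoʳ-≤ q x≤y ⟩
  q * y                                            ≡⟨ sym y′≡ ⟩
  (2 + d) * y′                                     ∎)
  where
  open ≤-Reasoning
  p = suc (suc n′ + suc d)
  q = suc ((1 + 2 * suc n′) + suc d)
  slack = suc n′ * (1 + d) * x + (1 + 2 * d + 2 * n′ + 2 * n′ * d) * c
  regroup : ∀ r s x c → r * (s * x + r * c) ≡ s * (r * x) + r * r * c
  regroup = solve-∀
  expand : ∀ d n′ c x →
    (3 + d) * (suc (suc n′ + suc d) * x) + (2 + d) * (2 + d) * c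
      + (suc n′ * (1 + d) * x + (1 + 2 * d + 2 * n′ + 2 * n′ * d) * c)
    ≡ suc ((1 + 2 * suc n′) + suc d) * ((2 + d) * x + (1 + d) * c)
  expand = solve-∀

B-bound : ∀ e c → (3 + e) * B (3 + e) (5 + c) + (2 + e) * c ≤ B (3 + e) (1 + 2 * (5 + c))
B-bound zero c = B-three-bound c
B-bound (suc e) c =
  bound-step (suc e) (4 + c) c {B (3 + e) n} {B (3 + e) N} {B (4 + e) n} {B (4 + e) N}
    (B-bound e c) (B-absorption (2 + e) n) (B-absorption (2 + e) N)
  where
  n = 5 + c
  N = 1 + 2 * n

lemma3p9 : ∀ (m d : ℕ) → 7 ≤ m → 2 ≤ d →
    (1 + d) * B (1 + d) (m ∸ 1) + d * (m ∸ 6) ≤ B (1 + d) (2 * m ∸ 1)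
lemma3p9 m@(suc (suc (suc (suc (suc (suc c)))))) (suc (suc e)) (s≤s (s≤s (s≤s (s≤s (s≤s (s≤s (s≤s _))))))) (s≤s (s≤s _)) =
  subst₂ _≤_ refl (sym (cong (λ k → B (3 + e) (k ∸ 1)) (*-suc 2 (m ∸ 1)))) (B-bound e c)
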